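{- Let $(L,{}')$ be a quantum logic. Two propositions $x, y \in L$ are compatible if and only if $x = (x \wedge y) \vee (x \wedge y')$ and $y = (y \wedge x) \vee (y \wedge x')$.
   Context: Let $L$ be a lattice with universal bounds $0$ and $1$. A mapping $': L\to L$ is a fuzzy negation if for all $x,y\in L$: $x \leqq (x')'$; $x\leqq y$ implies $y'\leqq x'$; $0'=1$ and $1'=0$. $(L,{}')$ is a logic if moreover $x\wedge x' = 0$ for all $x$, and a quantum logic if it is a logic satisfying the orthomodular identity: $x \leqq y$ implies $x \vee (x'\wedge y) = y$. Two elements $a,b\in L$ are orthogonal if $a\wedge b = 0$, $a \leqq b'$ and $b \leqq a'$. For $x,y\in L$, a triple $\{u,v,w\}\subseteq L$ is a compatible decomposition for $x$ and $y$ if (i) $u,v,w$ are pairwise orthogonal; (ii) $u\vee v = x$ and $v \vee w = y$; (iii) every pair $a,b$ of elements of the set $\{u,v,w,x,y,u',v',w',x',y'\}$ satisfies the orthomodular identity ($a\leqq b$ implies $a\vee(a'\wedge b) = b$). Elements $x,y$ are called compatible if a compatible decomposition for them exists. -}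

module Defs where

open import Level using (Level; _⊔_)
open import Data.Product using (_×_; ∃)
open import Relation.Binary.Lattice.Bundles using (BoundedLattice)

module _ {c ℓ₁ ℓ₂ : Level} (L : BoundedLattice c ℓ₁ ℓ₂) where
  open BoundedLattice L

  record IsFuzzyNegation (_′ : Carrier → Carrier) : Set (c ⊔ ℓ₁ ⊔ ℓ₂) where
    field
      involutive-≤ : ∀ x → x ≤ ((x ′) ′)
      antitone     : ∀ {x y} → x ≤ y → (y ′) ≤ (x ′)
      ⊥′           : (⊥ ′) ≈ ⊤
      ⊤′           : (⊤ ′) ≈ ⊥

  OMPair : (Carrier → Carrier) → Carrier → Carrier → Set (ℓ₁ ⊔ ℓ₂)
  OMPair _′ a b = a ≤ b → (a ∨ ((a ′) ∧ b)) ≈ b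

  record IsLogic (_′ : Carrier → Carrier) : Set (c ⊔ ℓ₁ ⊔ ℓ₂) where
    field
      isFuzzyNegation : IsFuzzyNegation _′
      noncontradiction : ∀ x → (x ∧ (x ′)) ≈ ⊥

  record IsQuantumLogic (_′ : Carrier → Carrier) : Set (c ⊔ ℓ₁ ⊔ ℓ₂) where
    field
      isLogic      : IsLogic _′
      orthomodular : ∀ x y → OMPair _′ x y

  Orthogonal : (Carrier → Carrier) → Carrier → Carrier → Set (ℓ₁ ⊔ ℓ₂)
  Orthogonal _′ a b = ((a ∧ b) ≈ ⊥) × (a ≤ (b ′)) × (b ≤ (a ′))

  data InTen (_′ : Carrier → Carrier) (u v w x y : Carrier) : Carrier → Set c where
    iu  : InTen _′ u v w x y u
    iv  : InTen _′ u v w x y v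
    iw  : InTen _′ u v w x y w
    ix  : InTen _′ u v w x y x
    iy  : InTen _′ u v w x y y
    iu′ : InTen _′ u v w x y (u ′)
    iv′ : InTen _′ u v w x y (v ′)
    iw′ : InTen _′ u v w x y (w ′)
    ix′ : InTen _′ u v w x y (x ′)
    iy′ : InTen _′ u v w x y (y ′)

  record CompatibleDecomposition (_′ : Carrier → Carrier) (x y u v w : Carrier)
         : Set (c ⊔ ℓ₁ ⊔ ℓ₂) where
    field
      orth-uv : Orthogonal _′ u v
      orth-uw : Orthogonal _′ u w
      orth-vw : Orthogonal _′ v w
      join-x  : (u ∨ v) ≈ x
      join-y  : (v ∨ w) ≈ y
      om-ten  : ∀ {a b} → InTen _′ u v w x y a → InTen _′ u v w x y b → OMPair _′ a b

  Compatible : (Carrier → Carrier) → Carrier → Carrier → Set (c ⊔ ℓ₁ ⊔ ℓ₂)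
  Compatible _′ x y = ∃ λ u → ∃ λ v → ∃ λ w → CompatibleDecomposition _′ x y u v w

-- A compatible decomposition {u, v, w} has u ≤ x ∧ y′ and v ≤ x ∧ y (orthogonality makes
-- u ≤ (v ∨ w)′ = y′), so x = u ∨ v lies below (x ∧ y) ∨ (x ∧ y′); symmetrically for y.
-- Conversely, u = x ∧ y′, v = x ∧ y, w = y ∧ x′ is a compatible decomposition: any two of
-- them lie below some p and p′ respectively, which forces orthogonality in a logic, and in
-- a quantum logic the orthomodular identity holds for every pair.
module Submission where

open import Defs
open import Level using (Level)
open import Data.Product using (_×_; _,_)
open import Function.Bundles using (_⇔_; mk⇔)
open import Relation.Binary.Lattice.Bundles using (Lattice; BoundedLattice)
import Relation.Binary.Lattice.Properties.JoinSemilattice as JoinSemilatticeProperties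
import Relation.Binary.Lattice.Properties.MeetSemilattice as MeetSemilatticeProperties

module LatticeProperties {c ℓ₁ ℓ₂ : Level} (L : Lattice c ℓ₁ ℓ₂) where
  open Lattice L
  open JoinSemilatticeProperties joinSemilattice using (∨-monotonic)

  split-by-meets : ∀ {u v x y z} → u ∨ v ≈ x → u ≤ y → v ≤ z → x ≈ (x ∧ y) ∨ (x ∧ z)
  split-by-meets {u} {v} {x} {y} {z} u∨v≈x u≤y v≤z = antisym
    (trans (reflexive (Eq.sym u∨v≈x))
           (∨-monotonic (∧-greatest u≤x u≤y) (∧-greatest v≤x v≤z)))
    (∨-least (x∧y≤x x y) (x∧y≤x x z))
    where
    u≤x : u ≤ x
    u≤x = trans (x≤x∨y u v) (reflexive u∨v≈x)
    v≤x : v ≤ x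
    v≤x = trans (y≤x∨y u v) (reflexive u∨v≈x)

module _ {c ℓ₁ ℓ₂ : Level} (L : BoundedLattice c ℓ₁ ℓ₂)
         (_′ : BoundedLattice.Carrier L → BoundedLattice.Carrier L) where
  open BoundedLattice L
  open LatticeProperties lattice
  open JoinSemilatticeProperties joinSemilattice using (∨-comm; ∨-cong)
  open MeetSemilatticeProperties meetSemilattice using (∧-comm; ∧-monotonic)

  SplitBy : Carrier → Carrier → Set ℓ₁
  SplitBy x y = x ≈ ((x ∧ y) ∨ (x ∧ (y ′)))

  module _ (isFuzzyNegation : IsFuzzyNegation L _′) where
    open IsFuzzyNegation isFuzzyNegation

    ≤′-swap : ∀ {a b} → a ≤ (b ′) → b ≤ (a ′)
    ≤′-swap {b = b} a≤b′ = trans (involutive-≤ b) (antitone a≤b′)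

    ≤′-∨ : ∀ {a b c} → a ≤ (b ′) → a ≤ (c ′) → a ≤ ((b ∨ c) ′)
    ≤′-∨ a≤b′ a≤c′ = ≤′-swap (∨-least (≤′-swap a≤b′) (≤′-swap a≤c′))

    Compatible⇒split : ∀ {x y} → Compatible L _′ x y → SplitBy x y × SplitBy y x
    Compatible⇒split {x} {y} (u , v , w , decomposition) =
        split-by-meets (Eq.trans (∨-comm v u) join-x) v≤y u≤y′
      , split-by-meets join-y v≤x w≤x′
      where
      open CompatibleDecomposition decomposition
      v≤x : v ≤ x
      v≤x = trans (y≤x∨y u v) (reflexive join-x)
      v≤y : v ≤ y
      v≤y = trans (x≤x∨y v w) (reflexive join-y)
      u≤y′ : u ≤ (y ′)
      u≤y′ = let (_ , u≤v′ , _) = orth-uv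
                 (_ , u≤w′ , _) = orth-uw
             in trans (≤′-∨ u≤v′ u≤w′) (antitone (reflexive (Eq.sym join-y)))
      w≤x′ : w ≤ (x ′)
      w≤x′ = let (_ , _ , w≤u′) = orth-uw
                 (_ , _ , w≤v′) = orth-vw
             in trans (≤′-∨ w≤u′ w≤v′) (antitone (reflexive (Eq.sym join-x)))

  module _ (isLogic : IsLogic L _′) where
    open IsLogic isLogic
    open IsFuzzyNegation isFuzzyNegation

    Orthogonal-sym : ∀ {a b} → Orthogonal L _′ a b → Orthogonal L _′ b a
    Orthogonal-sym {a} {b} (a∧b≈⊥ , a≤b′ , b≤a′) = (Eq.trans (∧-comm b a) a∧b≈⊥ , b≤a′ , a≤b′)

    separated⇒Orthogonal : ∀ {a b p} → a ≤ p → b ≤ (p ′) → Orthogonal L _′ a b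
    separated⇒Orthogonal {a} {b} {p} a≤p b≤p′ =
        antisym (trans (∧-monotonic a≤p b≤p′) (reflexive (noncontradiction p))) (minimum (a ∧ b))
      , trans a≤p (≤′-swap isFuzzyNegation b≤p′)
      , trans b≤p′ (antitone a≤p)

  split⇒Compatible : IsQuantumLogic L _′ →
                     ∀ {x y} → SplitBy x y → SplitBy y x → Compatible L _′ x y
  split⇒Compatible isQuantumLogic {x} {y} x-split y-split = x ∧ (y ′) , x ∧ y , y ∧ (x ′) , record
    { orth-uv = Orthogonal-sym isLogic (separated⇒Orthogonal isLogic (x∧y≤y x y) (x∧y≤y x (y ′)))
    ; orth-uw = separated⇒Orthogonal isLogic (x∧y≤x x (y ′)) (x∧y≤y y (x ′))
    ; orth-vw = separated⇒Orthogonal isLogic (x∧y≤x x y) (x∧y≤y y (x ′))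
    ; join-x  = Eq.trans (∨-comm _ _) (Eq.sym x-split)
    ; join-y  = Eq.trans (∨-cong (∧-comm x y) Eq.refl) (Eq.sym y-split)
    ; om-ten  = λ {a} {b} _ _ → orthomodular a b
    }
    where
    open IsQuantumLogic isQuantumLogic

mainTheorem8 : ∀ {c ℓ₁ ℓ₂ : Level} (L : BoundedLattice c ℓ₁ ℓ₂)
    (_′ : BoundedLattice.Carrier L → BoundedLattice.Carrier L) →
    IsQuantumLogic L _′ →
    ∀ x y →
    Compatible L _′ x y ⇔
    ((BoundedLattice._≈_ L x (BoundedLattice._∨_ L (BoundedLattice._∧_ L x y) (BoundedLattice._∧_ L x (y ′))))
    × (BoundedLattice._≈_ L y (BoundedLattice._∨_ L (BoundedLattice._∧_ L y x) (BoundedLattice._∧_ L y (x ′)))))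
mainTheorem8 L _′ isQuantumLogic x y = mk⇔
  (Compatible⇒split L _′ isFuzzyNegation)
  (λ (x-split , y-split) → split⇒Compatible L _′ isQuantumLogic x-split y-split)
  where
  open IsQuantumLogic isQuantumLogic using (isLogic)
  open IsLogic isLogic using (isFuzzyNegation)
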